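{- Let $-\ltimes U:\mathcal W\to\mathcal V$ be a multiplier for $U$. (1) If it is cancellative, affine and quantifiable, then the counit $\exists_U\mathrm{Fr}_U\to\mathrm{Id}$ is a natural isomorphism. (2) If it is semicartesian (so $\mathcal V=\mathcal W$), then: (a) if it is quantifiable, there is a natural transformation $\mathrm{Dom}_U\to\exists_U$; (b) if $\mathcal W$ has binary products with $U$, there is a natural transformation $\mathrm{Fr}_U\to\mathrm{Wk}_U$; (c) in any case there is a natural transformation $\mathrm{Dom}_U\circ\mathrm{Fr}_U\to\mathrm{Id}$. (3) If it is 3/4-cartesian, there is a natural transformation $\Sigma_{\delta}\circ\mathrm{Fr}_U\to\mathrm{Fr}_{U\ltimes U}$. (4) If it is cartesian, then $\exists_U\cong\mathrm{Dom}_U$, $\mathrm{Fr}_U\cong\mathrm{Wk}_U$, and $\exists_U\mathrm{Fr}_U\cong\mathrm{Dom}_U\mathrm{Wk}_U=(-\times U)\cong(-\ltimes U)$; moreover these isomorphisms become equalities for a suitable choice of $\mathrm{Dom}_U$ and $\mathrm{Wk}_U$ (which are defined only up to isomorphism).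
   Context: $\mathcal W$ has a terminal object $\top$. A multiplier for $U\in\mathcal V$ is a functor $-\ltimes U:\mathcal W\to\mathcal V$ with an isomorphism $\top\ltimes U\cong U$; $\pi_2:W\ltimes U\to U$ is $(!_W\ltimes U)$ followed by it. $\mathrm{Fr}_U:\mathcal W\to\mathcal V/U$, $W\mapsto(W\ltimes U,\pi_2)$, $f\mapsto f\ltimes U$. Cancellative: $\mathrm{Fr}_U$ faithful; affine: $\mathrm{Fr}_U$ full; quantifiable: $\mathrm{Fr}_U$ has a left adjoint $\exists_U$. The multiplier is endo if $\mathcal V=\mathcal W$; an endo multiplier is semicartesian if it has a natural transformation $\pi_1:W\ltimes U\to W$ (copointed); 3/4-cartesian if moreover there is a natural $\delta_W:W\ltimes U\to(W\ltimes U)\ltimes U$ making $(-\ltimes U,\pi_1,\delta)$ a comonad; cartesian if it is naturally isomorphic to $-\times U$ (compatibly with $\pi_2$). $\mathrm{Dom}_U:\mathcal W/U\to\mathcal W$ is the forgetful (domain) functor; $\mathrm{Wk}_U:\mathcal W\to\mathcal W/U$, $W\mapsto(W\times U,\pi_2)$ when products with $U$ exist. The composite $(-\ltimes U)\ltimes U$ is a multiplier for $U\ltimes U$ with fresh weakening $\mathrm{Fr}_{U\ltimes U}:\mathcal W\to\mathcal W/(U\ltimes U)$, $W\mapsto((W\ltimes U)\ltimes U,\pi_2)$; $\delta:U\to U\ltimes U$ denotes $\delta_\top$ transported along $\top\ltimes U\cong U$, and $\Sigma_\delta:\mathcal W/U\to\mathcal W/(U\ltimes U)$ is postcomposition with $\delta$.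 -}

module Defs where

open import Level using (Level; _⊔_) renaming (suc to lsuc)
open import Relation.Binary using (Rel; IsEquivalence)
open import Relation.Binary.PropositionalEquality using (_≡_; subst₂)
open import Data.Product using (Σ; _,_)

record Category (o ℓ e : Level) : Set (lsuc (o ⊔ ℓ ⊔ e)) where
  infixr 9 _∘_
  infix  4 _≈_
  field
    Obj : Set o
    _⇒_ : Obj → Obj → Set ℓ
    _≈_ : ∀ {A B} → Rel (A ⇒ B) e
    id  : ∀ {A} → A ⇒ A
    _∘_ : ∀ {A B C} → B ⇒ C → A ⇒ B → A ⇒ C
    equiv     : ∀ {A B} → IsEquivalence (_≈_ {A} {B})
    assoc     : ∀ {A B C D} {f : A ⇒ B} {g : B ⇒ C} {h : C ⇒ D} →
                (h ∘ g) ∘ f ≈ h ∘ (g ∘ f)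
    identityˡ : ∀ {A B} {f : A ⇒ B} → id ∘ f ≈ f
    identityʳ : ∀ {A B} {f : A ⇒ B} → f ∘ id ≈ f
    ∘-resp-≈  : ∀ {A B C} {f h : B ⇒ C} {g i : A ⇒ B} →
                f ≈ h → g ≈ i → f ∘ g ≈ h ∘ i

  module Eq {A B : Obj} = IsEquivalence (equiv {A} {B})

  infixr 2 _≈⟨_⟩_
  infix  3 _∎
  _≈⟨_⟩_ : ∀ {A B} (f : A ⇒ B) {g h : A ⇒ B} → f ≈ g → g ≈ h → f ≈ h
  f ≈⟨ p ⟩ q = Eq.trans p q
  _∎ : ∀ {A B} (f : A ⇒ B) → f ≈ f
  f ∎ = Eq.refl

  ∘-resp-≈ˡ : ∀ {A B C} {f h : B ⇒ C} {g : A ⇒ B} → f ≈ h → f ∘ g ≈ h ∘ g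
  ∘-resp-≈ˡ p = ∘-resp-≈ p Eq.refl
  ∘-resp-≈ʳ : ∀ {A B C} {f : B ⇒ C} {g i : A ⇒ B} → g ≈ i → f ∘ g ≈ f ∘ i
  ∘-resp-≈ʳ p = ∘-resp-≈ Eq.refl p

record IsIso {o ℓ e} (C : Category o ℓ e) {A B : Category.Obj C}
             (f : Category._⇒_ C A B) : Set (ℓ ⊔ e) where
  open Category C
  field
    inv  : B ⇒ A
    isoˡ : inv ∘ f ≈ id
    isoʳ : f ∘ inv ≈ id

record Iso {o ℓ e} (C : Category o ℓ e) (A B : Category.Obj C) : Set (ℓ ⊔ e) where
  open Category C
  field
    from : A ⇒ B
    to   : B ⇒ A
    isoˡ : to ∘ from ≈ id
    isoʳ : from ∘ to ≈ id

record Functor {o ℓ e o′ ℓ′ e′} (C : Category o ℓ e) (D : Category o′ ℓ′ e′)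
       : Set (o ⊔ ℓ ⊔ e ⊔ o′ ⊔ ℓ′ ⊔ e′) where
  private
    module C = Category C
    module D = Category D
  field
    F₀ : C.Obj → D.Obj
    F₁ : ∀ {A B} → A C.⇒ B → F₀ A D.⇒ F₀ B
    identity     : ∀ {A} → F₁ (C.id {A}) D.≈ D.id
    homomorphism : ∀ {X Y Z} {f : X C.⇒ Y} {g : Y C.⇒ Z} →
                   F₁ (g C.∘ f) D.≈ F₁ g D.∘ F₁ f
    F-resp-≈     : ∀ {A B} {f g : A C.⇒ B} → f C.≈ g → F₁ f D.≈ F₁ g

Idᶠ : ∀ {o ℓ e} {C : Category o ℓ e} → Functor C C
Idᶠ {C = C} = record
  { F₀ = λ X → X ; F₁ = λ f → f
  ; identity = Eq.refl ; homomorphism = Eq.refl ; F-resp-≈ = λ p → p }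
  where open Category C

infixr 9 _∘F_
_∘F_ : ∀ {o ℓ e o′ ℓ′ e′ o″ ℓ″ e″}
         {C : Category o ℓ e} {D : Category o′ ℓ′ e′} {E : Category o″ ℓ″ e″} →
       Functor D E → Functor C D → Functor C E
_∘F_ {E = E} G F = record
  { F₀ = λ X → G.F₀ (F.F₀ X)
  ; F₁ = λ f → G.F₁ (F.F₁ f)
  ; identity = E.Eq.trans (G.F-resp-≈ F.identity) G.identity
  ; homomorphism = E.Eq.trans (G.F-resp-≈ F.homomorphism) G.homomorphism
  ; F-resp-≈ = λ p → G.F-resp-≈ (F.F-resp-≈ p) }
  where
    module G = Functor G
    module F = Functor F
    module E = Category E

Faithful : ∀ {o ℓ e o′ ℓ′ e′} {C : Category o ℓ e} {D : Category o′ ℓ′ e′} →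
           Functor C D → Set (o ⊔ ℓ ⊔ e ⊔ e′)
Faithful {C = C} {D = D} F =
  ∀ {A B} (f g : A C.⇒ B) → F₁ f D.≈ F₁ g → f C.≈ g
  where
    module C = Category C
    module D = Category D
    open Functor F

Full : ∀ {o ℓ e o′ ℓ′ e′} {C : Category o ℓ e} {D : Category o′ ℓ′ e′} →
       Functor C D → Set (o ⊔ ℓ ⊔ ℓ′ ⊔ e′)
Full {C = C} {D = D} F =
  ∀ {A B} (g : F₀ A D.⇒ F₀ B) → Σ (A C.⇒ B) (λ f → F₁ f D.≈ g)
  where
    module C = Category C
    module D = Category D
    open Functor F

record NatTrans {o ℓ e o′ ℓ′ e′} {C : Category o ℓ e} {D : Category o′ ℓ′ e′}
                (F G : Functor C D) : Set (o ⊔ ℓ ⊔ ℓ′ ⊔ e′) where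
  private
    module C = Category C
    module D = Category D
    module F = Functor F
    module G = Functor G
  field
    η       : ∀ X → F.F₀ X D.⇒ G.F₀ X
    commute : ∀ {X Y} (f : X C.⇒ Y) → η Y D.∘ F.F₁ f D.≈ G.F₁ f D.∘ η X

record NaturalIso {o ℓ e o′ ℓ′ e′} {C : Category o ℓ e} {D : Category o′ ℓ′ e′}
                  (F G : Functor C D) : Set (o ⊔ ℓ ⊔ ℓ′ ⊔ e′) where
  field
    F⇒G : NatTrans F G
    iso : ∀ X → IsIso D (NatTrans.η F⇒G X)

record FunctorEq {o ℓ e o′ ℓ′ e′} {C : Category o ℓ e} {D : Category o′ ℓ′ e′}
                 (F G : Functor C D) : Set (o ⊔ ℓ ⊔ o′ ⊔ e′) where
  private
    module C = Category C
    module D = Category D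
    module F = Functor F
    module G = Functor G
  field
    eq₀ : ∀ X → F.F₀ X ≡ G.F₀ X
    eq₁ : ∀ {X Y} (f : X C.⇒ Y) →
          subst₂ D._⇒_ (eq₀ X) (eq₀ Y) (F.F₁ f) D.≈ G.F₁ f

record _⊣_ {o ℓ e o′ ℓ′ e′} {C : Category o ℓ e} {D : Category o′ ℓ′ e′}
           (L : Functor D C) (R : Functor C D) : Set (o ⊔ ℓ ⊔ e ⊔ o′ ⊔ ℓ′ ⊔ e′) where
  private
    module C = Category C
    module D = Category D
    module L = Functor L
    module R = Functor R
  field
    unit   : NatTrans Idᶠ (R ∘F L)
    counit : NatTrans (L ∘F R) Idᶠ
    zig    : ∀ {X} → NatTrans.η counit (L.F₀ X) C.∘ L.F₁ (NatTrans.η unit X) C.≈ C.id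
    zag    : ∀ {Y} → R.F₁ (NatTrans.η counit Y) D.∘ NatTrans.η unit (R.F₀ Y) D.≈ D.id

record Terminal {o ℓ e} (C : Category o ℓ e) : Set (o ⊔ ℓ ⊔ e) where
  open Category C
  field
    ⊤        : Obj
    !        : ∀ {A} → A ⇒ ⊤
    !-unique : ∀ {A} (f : A ⇒ ⊤) → ! ≈ f

record Product {o ℓ e} (C : Category o ℓ e) (A B : Category.Obj C) : Set (o ⊔ ℓ ⊔ e) where
  open Category C
  field
    A×B   : Obj
    π₁    : A×B ⇒ A
    π₂    : A×B ⇒ B
    ⟨_,_⟩ : ∀ {X} → X ⇒ A → X ⇒ B → X ⇒ A×B
    project₁ : ∀ {X} {f : X ⇒ A} {g : X ⇒ B} → π₁ ∘ ⟨ f , g ⟩ ≈ f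
    project₂ : ∀ {X} {f : X ⇒ A} {g : X ⇒ B} → π₂ ∘ ⟨ f , g ⟩ ≈ g
    unique   : ∀ {X} {h : X ⇒ A×B} {f : X ⇒ A} {g : X ⇒ B} →
               π₁ ∘ h ≈ f → π₂ ∘ h ≈ g → ⟨ f , g ⟩ ≈ h

ProductsWith : ∀ {o ℓ e} (C : Category o ℓ e) (U : Category.Obj C) → Set (o ⊔ ℓ ⊔ e)
ProductsWith C U = ∀ X → Product C X U

module _ {o ℓ e} (C : Category o ℓ e) (U : Category.Obj C) where
  open Category C

  record SliceObj : Set (o ⊔ ℓ) where
    constructor sliceobj
    field
      dom : Obj
      arr : dom ⇒ U

  record Slice⇒ (X Y : SliceObj) : Set (ℓ ⊔ e) where
    constructor slicearr
    field
      h : SliceObj.dom X ⇒ SliceObj.dom Y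
      △ : SliceObj.arr Y ∘ h ≈ SliceObj.arr X

  Slice : Category (o ⊔ ℓ) (ℓ ⊔ e) e
  Slice = record
    { Obj = SliceObj
    ; _⇒_ = Slice⇒
    ; _≈_ = λ f g → Slice⇒.h f ≈ Slice⇒.h g
    ; id  = λ {A} → slicearr id identityʳ
    ; _∘_ = λ {A} {B} {C′} g f → slicearr (Slice⇒.h g ∘ Slice⇒.h f)
              (Eq.trans (Eq.sym assoc)
                (Eq.trans (∘-resp-≈ˡ (Slice⇒.△ g)) (Slice⇒.△ f)))
    ; equiv = record { refl = Eq.refl ; sym = Eq.sym ; trans = Eq.trans }
    ; assoc = assoc
    ; identityˡ = identityˡ
    ; identityʳ = identityʳ
    ; ∘-resp-≈ = ∘-resp-≈
    }

  Dom : Functor Slice C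
  Dom = record
    { F₀ = SliceObj.dom ; F₁ = Slice⇒.h
    ; identity = Eq.refl ; homomorphism = Eq.refl ; F-resp-≈ = λ p → p }

  module _ (P : ProductsWith C U) where
    private module P X = Product (P X)

    ×U : Functor C C
    ×U = record
      { F₀ = λ X → P.A×B X
      ; F₁ = λ {X} {Y} f → P.⟨_,_⟩ Y (f ∘ P.π₁ X) (P.π₂ X)
      ; identity = λ {X} → P.unique X (Eq.trans identityʳ (Eq.sym identityˡ)) identityʳ
      ; homomorphism = λ {X} {Y} {Z} {f} {g} → P.unique Z
          (Eq.trans (Eq.sym assoc) (Eq.trans (∘-resp-≈ˡ (P.project₁ Z))
            (Eq.trans assoc (Eq.trans (∘-resp-≈ʳ (P.project₁ Y)) (Eq.sym assoc)))))
          (Eq.trans (Eq.sym assoc) (Eq.trans (∘-resp-≈ˡ (P.project₂ Z)) (P.project₂ Y)))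
      ; F-resp-≈ = λ {X} {Y} p → P.unique Y
          (Eq.trans (P.project₁ Y) (∘-resp-≈ˡ (Eq.sym p))) (P.project₂ Y)
      }

    Wk : Functor C Slice
    Wk = record
      { F₀ = λ X → sliceobj (P.A×B X) (P.π₂ X)
      ; F₁ = λ {X} {Y} f → slicearr (Functor.F₁ ×U f) (P.project₂ Y)
      ; identity = Functor.identity ×U
      ; homomorphism = Functor.homomorphism ×U
      ; F-resp-≈ = Functor.F-resp-≈ ×U
      }

SliceΣ : ∀ {o ℓ e} {C : Category o ℓ e} {U U′ : Category.Obj C} →
         Category._⇒_ C U U′ → Functor (Slice C U) (Slice C U′)
SliceΣ {C = C} {U} {U′} d = record
  { F₀ = λ X → sliceobj (SliceObj.dom X) (d ∘ SliceObj.arr X)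
  ; F₁ = λ f → slicearr (Slice⇒.h f) (Eq.trans assoc (∘-resp-≈ʳ (Slice⇒.△ f)))
  ; identity = Eq.refl ; homomorphism = Eq.refl ; F-resp-≈ = λ p → p }
  where open Category C

record Multiplier {o ℓ e o′ ℓ′ e′} (W : Category o ℓ e) (V : Category o′ ℓ′ e′)
                  (T : Terminal W) (U : Category.Obj V)
                  : Set (o ⊔ ℓ ⊔ e ⊔ o′ ⊔ ℓ′ ⊔ e′) where
  field
    ⋉U     : Functor W V
    unitor : Iso V (Functor.F₀ ⋉U (Terminal.⊤ T)) U

module _ {o ℓ e o′ ℓ′ e′} {W : Category o ℓ e} {V : Category o′ ℓ′ e′}
         {T : Terminal W} {U : Category.Obj V} (M : Multiplier W V T U) where
  private
    module W = Category W
    module V = Category V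
    open Terminal T
    open Multiplier M
    module M = Functor ⋉U

  π₂ : ∀ X → M.F₀ X V.⇒ U
  π₂ X = Iso.from unitor V.∘ M.F₁ (! {X})

  Fr : Functor W (Slice V U)
  Fr = record
    { F₀ = λ X → sliceobj (M.F₀ X) (π₂ X)
    ; F₁ = λ {X} {Y} f → slicearr (M.F₁ f)
        (V.Eq.trans V.assoc (V.∘-resp-≈ʳ (V.Eq.trans (V.Eq.sym M.homomorphism)
          (M.F-resp-≈ (W.Eq.sym (!-unique (! W.∘ f)))))))
    ; identity = M.identity ; homomorphism = M.homomorphism ; F-resp-≈ = M.F-resp-≈ }

module _ {o ℓ e} {C : Category o ℓ e} {T : Terminal C} {U : Category.Obj C}
         (M : Multiplier C C T U) where
  private
    module C = Category C
    open Terminal T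
    open Multiplier M
    module M = Functor ⋉U

  record Semicartesian : Set (o ⊔ ℓ ⊔ e) where
    field
      π₁ : NatTrans ⋉U Idᶠ

  record ThreeQuarterCartesian : Set (o ⊔ ℓ ⊔ e) where
    field
      π₁ : NatTrans ⋉U Idᶠ
      δ  : NatTrans ⋉U (⋉U ∘F ⋉U)
    private
      module π₁ = NatTrans π₁
      module δ = NatTrans δ
    field
      counitˡ : ∀ {X} → π₁.η (M.F₀ X) C.∘ δ.η X C.≈ C.id
      counitʳ : ∀ {X} → M.F₁ (π₁.η X) C.∘ δ.η X C.≈ C.id
      coassoc : ∀ {X} → δ.η (M.F₀ X) C.∘ δ.η X C.≈ M.F₁ (δ.η X) C.∘ δ.η X

  record Cartesian : Set (o ⊔ ℓ ⊔ e) where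
    field
      products : ProductsWith C U
      φ        : NaturalIso ⋉U (×U C U products)
      compat   : ∀ X → Product.π₂ (products X) C.∘ NatTrans.η (NaturalIso.F⇒G φ) X
                         C.≈ π₂ M X

  double : Multiplier C C T (M.F₀ U)
  double = record
    { ⋉U = ⋉U ∘F ⋉U
    ; unitor = record
      { from = M.F₁ (Iso.from unitor)
      ; to   = M.F₁ (Iso.to unitor)
      ; isoˡ = C.Eq.trans (C.Eq.sym M.homomorphism)
                 (C.Eq.trans (M.F-resp-≈ (Iso.isoˡ unitor)) M.identity)
      ; isoʳ = C.Eq.trans (C.Eq.sym M.homomorphism)
                 (C.Eq.trans (M.F-resp-≈ (Iso.isoʳ unitor)) M.identity)
      }
    }

  -- δ : U → U ⋉ U, i.e. δ_⊤ transported along ⊤ ⋉ U ≅ U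
  δU : ThreeQuarterCartesian → U C.⇒ M.F₀ U
  δU TQ = M.F₁ (Iso.from unitor) C.∘ (NatTrans.η (ThreeQuarterCartesian.δ TQ) ⊤ C.∘ Iso.to unitor)

-- Part (1) is the general fact that the counit of an adjunction is invertible as soon as
-- the right adjoint is full and faithful.  The map in (2a) is the mate of π₁ : Dom_U Fr_U → Id
-- under ∃_U ⊣ Fr_U; the other maps in (2) and (3) are assembled from π₁, the pairing
-- ⟨ π₁ , π₂ ⟩ and the comultiplication δ.  For (4), the isomorphism φ : W ⋉ U ≅ W × U
-- identifies Fr_U with Wk_U, and Dom_U ⊣ Wk_U, so Dom_U ⊣ Fr_U and uniqueness of left
-- adjoints gives ∃_U ≅ Dom_U.  Transporting the chosen products along φ makes W ⋉ U itself a
-- product of W and U with second projection π₂, for which Wk_U is Fr_U on the nose.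
module Submission where

open import Level using (Level)
open import Data.Product using (_×_; Σ; _,_)
open import Relation.Binary.PropositionalEquality using (refl)

open import Defs

module MorphismReasoning {o ℓ e} (C : Category o ℓ e) where
  open Category C

  module _ {A B D : Obj} {f : A ⇒ B} {g : B ⇒ D} {h : A ⇒ D} (gf≈h : g ∘ f ≈ h) where
    pullˡ : ∀ {Z} {k : Z ⇒ A} → g ∘ (f ∘ k) ≈ h ∘ k
    pullˡ = Eq.trans (Eq.sym assoc) (∘-resp-≈ˡ gf≈h)

    pullʳ : ∀ {E} {k : D ⇒ E} → (k ∘ g) ∘ f ≈ k ∘ h
    pullʳ = Eq.trans assoc (∘-resp-≈ʳ gf≈h)

  module _ {A B : Obj} {f : A ⇒ B} {g : B ⇒ A} (gf≈id : g ∘ f ≈ id) where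
    cancelˡ : ∀ {Z} {k : Z ⇒ A} → g ∘ (f ∘ k) ≈ k
    cancelˡ = Eq.trans (pullˡ gf≈id) identityˡ

    cancelʳ : ∀ {E} {k : A ⇒ E} → (k ∘ g) ∘ f ≈ k
    cancelʳ = Eq.trans (pullʳ gf≈id) identityʳ

    cancelInner : ∀ {Z E} {k : Z ⇒ A} {l : A ⇒ E} → (l ∘ g) ∘ (f ∘ k) ≈ l ∘ k
    cancelInner = Eq.trans assoc (∘-resp-≈ʳ cancelˡ)

module _ {o ℓ e} {C : Category o ℓ e} where
  open Category C
  open MorphismReasoning C

  IsIso-∘ : ∀ {A B D} {f : A ⇒ B} {g : B ⇒ D} → IsIso C g → IsIso C f → IsIso C (g ∘ f)
  IsIso-∘ g-iso f-iso = record
    { inv  = F.inv ∘ G.inv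
    ; isoˡ = Eq.trans (cancelInner G.isoˡ) F.isoˡ
    ; isoʳ = Eq.trans (cancelInner F.isoʳ) G.isoʳ
    }
    where
      module F = IsIso f-iso
      module G = IsIso g-iso

module _ {o ℓ e o′ ℓ′ e′} {C : Category o ℓ e} {D : Category o′ ℓ′ e′} where
  private
    module C = Category C
  open Category D

  Functor-resp-IsIso : (F : Functor C D) → ∀ {A B} {f : A C.⇒ B} →
                       IsIso C f → IsIso D (Functor.F₁ F f)
  Functor-resp-IsIso F f-iso = record
    { inv  = F.F₁ inv
    ; isoˡ = Eq.trans (Eq.sym F.homomorphism) (Eq.trans (F.F-resp-≈ isoˡ) F.identity)
    ; isoʳ = Eq.trans (Eq.sym F.homomorphism) (Eq.trans (F.F-resp-≈ isoʳ) F.identity)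
    }
    where
      module F = Functor F
      open IsIso f-iso

module _ {o ℓ e o′ ℓ′ e′} {C : Category o ℓ e} {D : Category o′ ℓ′ e′} where
  private
    module C = Category C
  open Category D
  open MorphismReasoning D

  NaturalIso-sym : {F G : Functor C D} → NaturalIso F G → NaturalIso G F
  NaturalIso-sym {F} {G} α = record
    { F⇒G = record { η = iso.inv ; commute = commute }
    ; iso = λ X → record { inv = a.η X ; isoˡ = iso.isoʳ X ; isoʳ = iso.isoˡ X }
    }
    where
      module F = Functor F
      module G = Functor G
      module a = NatTrans (NaturalIso.F⇒G α)
      module iso X = IsIso (NaturalIso.iso α X)
      commute : ∀ {X Y} (f : X C.⇒ Y) → iso.inv Y ∘ G.F₁ f ≈ F.F₁ f ∘ iso.inv X
      commute {X} {Y} f =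
        iso.inv Y ∘ G.F₁ f                          ≈⟨ ∘-resp-≈ʳ (Eq.sym (Eq.trans (∘-resp-≈ʳ (iso.isoʳ X)) identityʳ)) ⟩
        iso.inv Y ∘ (G.F₁ f ∘ (a.η X ∘ iso.inv X))  ≈⟨ ∘-resp-≈ʳ (pullˡ (Eq.sym (a.commute f))) ⟩
        iso.inv Y ∘ ((a.η Y ∘ F.F₁ f) ∘ iso.inv X)  ≈⟨ ∘-resp-≈ʳ assoc ⟩
        iso.inv Y ∘ (a.η Y ∘ (F.F₁ f ∘ iso.inv X))  ≈⟨ cancelˡ (iso.isoˡ Y) ⟩
        F.F₁ f ∘ iso.inv X                          ∎

  NaturalIso-trans : {F G H : Functor C D} → NaturalIso F G → NaturalIso G H → NaturalIso F H
  NaturalIso-trans α β = record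
    { F⇒G = record
      { η       = λ X → b.η X ∘ a.η X
      ; commute = λ f → Eq.trans (pullʳ (a.commute f)) (Eq.trans (pullˡ (b.commute f)) assoc)
      }
    ; iso = λ X → IsIso-∘ (NaturalIso.iso β X) (NaturalIso.iso α X)
    }
    where
      module a = NatTrans (NaturalIso.F⇒G α)
      module b = NatTrans (NaturalIso.F⇒G β)

  infixr 9 _∘ʳ_ _∘ˡ_

  _∘ʳ_ : ∀ {o″ ℓ″ e″} {B : Category o″ ℓ″ e″} {F G : Functor C D} →
         NaturalIso F G → (K : Functor B C) → NaturalIso (F ∘F K) (G ∘F K)
  α ∘ʳ K = record
    { F⇒G = record { η = λ X → a.η (K.F₀ X) ; commute = λ f → a.commute (K.F₁ f) }
    ; iso = λ X → NaturalIso.iso α (K.F₀ X)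
    }
    where
      module a = NatTrans (NaturalIso.F⇒G α)
      module K = Functor K

  _∘ˡ_ : ∀ {o″ ℓ″ e″} {E : Category o″ ℓ″ e″} {F G : Functor C D} →
         (K : Functor D E) → NaturalIso F G → NaturalIso (K ∘F F) (K ∘F G)
  _∘ˡ_ {E = E} K α = record
    { F⇒G = record
      { η       = λ X → K.F₁ (a.η X)
      ; commute = λ f → E.Eq.trans (E.Eq.sym K.homomorphism)
                          (E.Eq.trans (K.F-resp-≈ (a.commute f)) K.homomorphism)
      }
    ; iso = λ X → Functor-resp-IsIso K (NaturalIso.iso α X)
    }
    where
      module E = Category E
      module K = Functor K
      module a = NatTrans (NaturalIso.F⇒G α)

module Transpose {o ℓ e o′ ℓ′ e′} {C : Category o ℓ e} {D : Category o′ ℓ′ e′}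
                 {R : Functor C D} (G : Functor D C) (ρ : NatTrans (G ∘F R) Idᶠ) where
  private
    module D = Category D
    module G = Functor G
    module R = Functor R
    module ρ = NatTrans ρ
  open Category C
  open MorphismReasoning C

  transpose : ∀ {X Y} → X D.⇒ R.F₀ Y → G.F₀ X ⇒ Y
  transpose g = ρ.η _ ∘ G.F₁ g

  transpose-square : ∀ {X X′ Y Y′} {g : X D.⇒ R.F₀ Y} {g′ : X′ D.⇒ R.F₀ Y′}
                     {u : X′ D.⇒ X} {v : Y′ ⇒ Y} →
                     g D.∘ u D.≈ R.F₁ v D.∘ g′ → transpose g ∘ G.F₁ u ≈ v ∘ transpose g′
  transpose-square {Y = Y} {Y′} {g} {g′} {u} {v} square =
    (ρ.η Y ∘ G.F₁ g) ∘ G.F₁ u             ≈⟨ pullʳ (Eq.sym G.homomorphism) ⟩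
    ρ.η Y ∘ G.F₁ (g D.∘ u)                ≈⟨ ∘-resp-≈ʳ (G.F-resp-≈ square) ⟩
    ρ.η Y ∘ G.F₁ (R.F₁ v D.∘ g′)          ≈⟨ ∘-resp-≈ʳ G.homomorphism ⟩
    ρ.η Y ∘ (G.F₁ (R.F₁ v) ∘ G.F₁ g′)     ≈⟨ pullˡ (ρ.commute v) ⟩
    (v ∘ ρ.η Y′) ∘ G.F₁ g′                ≈⟨ assoc ⟩
    v ∘ transpose g′                      ∎

module Adjunction {o ℓ e o′ ℓ′ e′} {C : Category o ℓ e} {D : Category o′ ℓ′ e′}
                  {L : Functor D C} {R : Functor C D} (adj : L ⊣ R) where
  private
    module C = Category C
    module D = Category D
    module L = Functor L
    module R = Functor R
    module η = NatTrans (_⊣_.unit adj)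
    module ε = NatTrans (_⊣_.counit adj)
    module MC = MorphismReasoning C
    module MD = MorphismReasoning D
  open _⊣_ adj using (zig; zag)
  open Transpose L (_⊣_.counit adj) public
    using () renaming (transpose to Radjunct; transpose-square to Radjunct-square)

  Ladjunct : ∀ {X Y} → L.F₀ X C.⇒ Y → X D.⇒ R.F₀ Y
  Ladjunct k = R.F₁ k D.∘ η.η _

  RLadjunct≈id : ∀ {X Y} (k : L.F₀ X C.⇒ Y) → Radjunct (Ladjunct k) C.≈ k
  RLadjunct≈id k = C.Eq.trans (C.∘-resp-≈ʳ L.homomorphism)
                     (C.Eq.trans (MC.pullˡ (ε.commute k)) (MC.cancelʳ zig))

  LRadjunct≈id : ∀ {X Y} (g : X D.⇒ R.F₀ Y) → Ladjunct (Radjunct g) D.≈ g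
  LRadjunct≈id g = D.Eq.trans (D.∘-resp-≈ˡ R.homomorphism)
                     (D.Eq.trans (MD.pullʳ (D.Eq.sym (η.commute g))) (MD.cancelˡ zag))

  Ladjunct≈unit⇒≈id : ∀ {X} (k : L.F₀ X C.⇒ L.F₀ X) → Ladjunct k D.≈ η.η X → k C.≈ C.id
  Ladjunct≈unit⇒≈id k p =
    C.Eq.trans (C.Eq.sym (RLadjunct≈id k)) (C.Eq.trans (C.∘-resp-≈ʳ (L.F-resp-≈ p)) zig)

  counit-isIso : Faithful R → Full R → ∀ X → IsIso C (ε.η X)
  counit-isIso faithful full X = record
    { inv  = g
    ; isoˡ = Ladjunct≈unit⇒≈id (g C.∘ ε.η X)
               (D.Eq.trans (D.∘-resp-≈ˡ R.homomorphism) (D.Eq.trans (MD.cancelʳ zag) Rg≈η))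
    ; isoʳ = faithful (ε.η X C.∘ g) C.id
               (D.Eq.trans R.homomorphism
                 (D.Eq.trans (D.∘-resp-≈ʳ Rg≈η) (D.Eq.trans zag (D.Eq.sym R.identity))))
    }
    where
      open Σ (full (η.η (R.F₀ X))) renaming (proj₁ to g; proj₂ to Rg≈η)

module _ {o ℓ e o′ ℓ′ e′} {C : Category o ℓ e} {D : Category o′ ℓ′ e′} where
  private
    module D = Category D
  open Category C
  open MorphismReasoning C
  open Adjunction

  comparison : ∀ {L L′ : Functor D C} {R : Functor C D} → L ⊣ R → L′ ⊣ R →
               ∀ X → Functor.F₀ L X ⇒ Functor.F₀ L′ X
  comparison adj adj′ X = Radjunct adj (NatTrans.η (_⊣_.unit adj′) X)

  -- The composite transposes to the unit of adj, by LRadjunct≈id for adj and then adj′.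
  comparison-retraction : ∀ {L L′ : Functor D C} {R : Functor C D}
                          (adj : L ⊣ R) (adj′ : L′ ⊣ R) →
                          ∀ X → comparison adj′ adj X ∘ comparison adj adj′ X ≈ id
  comparison-retraction {R = R} adj adj′ X =
    Ladjunct≈unit⇒≈id adj _
      (D.Eq.trans (D.∘-resp-≈ˡ (Functor.homomorphism R))
        (D.Eq.trans (MorphismReasoning.pullʳ D (LRadjunct≈id adj _)) (LRadjunct≈id adj′ _)))

  left-adjoint-unique : ∀ {L L′ : Functor D C} {R : Functor C D} →
                        L ⊣ R → L′ ⊣ R → NaturalIso L L′
  left-adjoint-unique adj adj′ = record
    { F⇒G = record
      { η       = comparison adj adj′
      ; commute = λ f → Radjunct-square adj (NatTrans.commute (_⊣_.unit adj′) f)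
      }
    ; iso = λ X → record
      { inv  = comparison adj′ adj X
      ; isoˡ = comparison-retraction adj adj′ X
      ; isoʳ = comparison-retraction adj′ adj X
      }
    }

  ⊣-respʳ-NaturalIso : ∀ {L : Functor D C} {R R′ : Functor C D} →
                       L ⊣ R → NaturalIso R R′ → L ⊣ R′
  ⊣-respʳ-NaturalIso {L} adj α = record
    { unit   = record
      { η       = λ X → a.η (L.F₀ X) D.∘ η.η X
      ; commute = λ f → D.Eq.trans (MD.pullʳ (η.commute f))
                          (D.Eq.trans (MD.pullˡ (a.commute (L.F₁ f))) D.assoc)
      }
    ; counit = record
      { η       = λ Y → Radjunct adj (a⁻¹.η Y)
      ; commute = λ f → Radjunct-square adj (a⁻¹.commute f)
      }
    ; zig    = Eq.trans (pullʳ (Eq.sym L.homomorphism))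
                 (Eq.trans (∘-resp-≈ʳ (L.F-resp-≈ (MD.cancelˡ (iso.isoˡ _)))) (_⊣_.zig adj))
    ; zag    = D.Eq.trans (MD.pullˡ (D.Eq.sym (a.commute _)))
                 (D.Eq.trans (MD.pullʳ (LRadjunct≈id adj _)) (iso.isoʳ _))
    }
    where
      module L = Functor L
      module MD = MorphismReasoning D
      module η = NatTrans (_⊣_.unit adj)
      module a = NatTrans (NaturalIso.F⇒G α)
      module a⁻¹ = NatTrans (NaturalIso.F⇒G (NaturalIso-sym α))
      module iso X = IsIso (NaturalIso.iso α X)

  mate : ∀ {L : Functor D C} {R : Functor C D} → L ⊣ R →
         (G : Functor D C) → NatTrans (G ∘F R) Idᶠ → NatTrans G L
  mate adj G ρ = record
    { η       = λ X → transpose (NatTrans.η (_⊣_.unit adj) X)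
    ; commute = λ f → transpose-square (NatTrans.commute (_⊣_.unit adj) f)
    }
    where open Transpose G ρ

module _ {o ℓ e} {C : Category o ℓ e} {A B : Category.Obj C} (P : Product C A B) where
  open Category C
  open MorphismReasoning C
  private module P = Product P

  ⟨⟩-cong₂ : ∀ {X} {f f′ : X ⇒ A} {g g′ : X ⇒ B} → f ≈ f′ → g ≈ g′ → P.⟨ f , g ⟩ ≈ P.⟨ f′ , g′ ⟩
  ⟨⟩-cong₂ f≈f′ g≈g′ =
    P.unique (Eq.trans P.project₁ (Eq.sym f≈f′)) (Eq.trans P.project₂ (Eq.sym g≈g′))

  ⟨⟩∘ : ∀ {X Y} {f : X ⇒ A} {g : X ⇒ B} {h : Y ⇒ X} → P.⟨ f , g ⟩ ∘ h ≈ P.⟨ f ∘ h , g ∘ h ⟩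
  ⟨⟩∘ = Eq.sym (P.unique (pullˡ P.project₁) (pullˡ P.project₂))

  Product-transport : ∀ {X} {f : X ⇒ P.A×B} → IsIso C f → (p₁ : X ⇒ A) (p₂ : X ⇒ B) →
                      P.π₁ ∘ f ≈ p₁ → P.π₂ ∘ f ≈ p₂ → Product C A B
  Product-transport {X} {f} f-iso p₁ p₂ π₁∘f≈p₁ π₂∘f≈p₂ = record
    { A×B      = X
    ; π₁       = p₁
    ; π₂       = p₂
    ; ⟨_,_⟩    = λ g h → inv ∘ P.⟨ g , h ⟩
    ; project₁ = Eq.trans (∘-resp-≈ˡ (Eq.sym π₁∘f≈p₁)) (Eq.trans (cancelInner isoʳ) P.project₁)
    ; project₂ = Eq.trans (∘-resp-≈ˡ (Eq.sym π₂∘f≈p₂)) (Eq.trans (cancelInner isoʳ) P.project₂)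
    ; unique   = λ p q → Eq.trans (∘-resp-≈ʳ (P.unique (Eq.trans (pullˡ π₁∘f≈p₁) p)
                                                       (Eq.trans (pullˡ π₂∘f≈p₂) q)))
                                  (cancelˡ isoˡ)
    }
    where open IsIso f-iso

module _ {o ℓ e} {C : Category o ℓ e} {U : Category.Obj C} (P : ProductsWith C U) where
  open Category C
  open MorphismReasoning C
  private
    module P X = Product (P X)
    module ×U = Functor (×U C U P)

  ×U₁∘⟨⟩ : ∀ {X Y Z} {k : X ⇒ Y} {f : Z ⇒ X} {g : Z ⇒ U} →
           ×U.F₁ k ∘ P.⟨_,_⟩ X f g ≈ P.⟨_,_⟩ Y (k ∘ f) g
  ×U₁∘⟨⟩ {X} {Y} = Eq.trans (⟨⟩∘ (P Y)) (⟨⟩-cong₂ (P Y) (pullʳ (P.project₁ X)) (P.project₂ X))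

  Dom∘Wk≡×U : FunctorEq (Dom C U ∘F Wk C U P) (×U C U P)
  Dom∘Wk≡×U = record { eq₀ = λ X → refl ; eq₁ = λ f → Eq.refl }

  Dom⊣Wk : Dom C U ⊣ Wk C U P
  Dom⊣Wk = record
    { unit   = record
      { η       = λ A → slicearr (pair A) (P.project₂ _)
      ; commute = λ k → Eq.trans (⟨⟩∘ (P _))
                    (Eq.trans (⟨⟩-cong₂ (P _) (Eq.trans identityˡ (Eq.sym identityʳ))
                                              (Slice⇒.△ k))
                              (Eq.sym ×U₁∘⟨⟩))
      }
    ; counit = record { η = P.π₁ ; commute = λ f → P.project₁ _ }
    ; zig    = P.project₁ _
    ; zag    = Eq.trans ×U₁∘⟨⟩ (P.unique _ Eq.refl identityʳ)
    }
    where
      pair : ∀ A → SliceObj.dom A ⇒ P.A×B (SliceObj.dom A)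
      pair A = P.⟨_,_⟩ _ id (SliceObj.arr A)

module _ {o ℓ e} {C : Category o ℓ e} {U : Category.Obj C} where
  open Category C
  open MorphismReasoning C

  Slice-IsIso : ∀ {A B : SliceObj C U} (f : Slice⇒ C U A B) →
                IsIso C (Slice⇒.h f) → IsIso (Slice C U) f
  Slice-IsIso f f-iso = record
    { inv  = slicearr inv (Eq.trans (∘-resp-≈ˡ (Eq.sym (Slice⇒.△ f))) (cancelʳ isoʳ))
    ; isoˡ = isoˡ
    ; isoʳ = isoʳ
    }
    where open IsIso f-iso

module _ {o ℓ e} {C : Category o ℓ e} {T : Terminal C} {U : Category.Obj C}
         (M : Multiplier C C T U) where
  open Category C
  open MorphismReasoning C
  private
    module ⋉U = Functor (Multiplier.⋉U M)
    module Fr = Functor (Fr M)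

  module _ (sc : Semicartesian M) where
    private
      module π₁ = NatTrans (Semicartesian.π₁ sc)

    Dom∘Fr⇒Id : NatTrans (Dom C U ∘F Fr M) Idᶠ
    Dom∘Fr⇒Id = record { η = π₁.η ; commute = π₁.commute }

    Dom⇒∃ : (∃U : Functor (Slice C U) C) → ∃U ⊣ Fr M → NatTrans (Dom C U) ∃U
    Dom⇒∃ ∃U adj = mate adj (Dom C U) Dom∘Fr⇒Id

    Fr⇒Wk : (P : ProductsWith C U) → NatTrans (Fr M) (Wk C U P)
    Fr⇒Wk P = record
      { η       = λ X → slicearr (P.⟨_,_⟩ X (π₁.η X) (π₂ M X)) (P.project₂ X)
      ; commute = λ f → Eq.trans (⟨⟩∘ (P _))
                          (Eq.trans (⟨⟩-cong₂ (P _) (π₁.commute f) (Slice⇒.△ (Fr.F₁ f)))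
                                    (Eq.sym (×U₁∘⟨⟩ P)))
      }
      where module P X = Product (P X)

  module _ (tq : ThreeQuarterCartesian M) where
    private
      module δ = NatTrans (ThreeQuarterCartesian.δ tq)
    open Iso (Multiplier.unitor M)
    open Terminal T

    Σδ∘Fr⇒Fr² : NatTrans (SliceΣ (δU M tq) ∘F Fr M) (Fr (double M))
    Σδ∘Fr⇒Fr² = record { η = λ X → slicearr (δ.η X) (triangle X) ; commute = δ.commute }
      where
        triangle : ∀ X → π₂ (double M) X ∘ δ.η X ≈ δU M tq ∘ π₂ M X
        triangle X = Eq.trans (pullʳ (Eq.sym (δ.commute !)))
                       (Eq.sym (Eq.trans assoc (∘-resp-≈ʳ (cancelInner isoˡ))))

  module _ (cart : Cartesian M) where
    open Cartesian cart using (products; φ; compat)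
    private
      module φ = NatTrans (NaturalIso.F⇒G φ)
      module P X = Product (products X)

    Fr≅Wk : NaturalIso (Fr M) (Wk C U products)
    Fr≅Wk = record
      { F⇒G = record { η = λ X → slicearr (φ.η X) (compat X) ; commute = φ.commute }
      ; iso = λ X → Slice-IsIso _ (NaturalIso.iso φ X)
      }

    Dom⊣Fr : Dom C U ⊣ Fr M
    Dom⊣Fr = ⊣-respʳ-NaturalIso (Dom⊣Wk products) (NaturalIso-sym Fr≅Wk)

    ∃≅Dom : (∃U : Functor (Slice C U) C) → ∃U ⊣ Fr M → NaturalIso ∃U (Dom C U)
    ∃≅Dom ∃U adj = left-adjoint-unique adj Dom⊣Fr

    ∃∘Fr≅Dom∘Wk : (∃U : Functor (Slice C U) C) → ∃U ⊣ Fr M →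
                  NaturalIso (∃U ∘F Fr M) (Dom C U ∘F Wk C U products)
    ∃∘Fr≅Dom∘Wk ∃U adj = NaturalIso-trans (∃≅Dom ∃U adj ∘ʳ Fr M) (Dom C U ∘ˡ Fr≅Wk)

    products⋉ : ProductsWith C U
    products⋉ X = Product-transport (products X) (NaturalIso.iso φ X)
                    (P.π₁ X ∘ φ.η X) (π₂ M X) Eq.refl (compat X)

    ×U₁≈⋉U₁ : ∀ {X Y} (f : X ⇒ Y) → Functor.F₁ (×U C U products⋉) f ≈ ⋉U.F₁ f
    ×U₁≈⋉U₁ {X} {Y} f = Product.unique (products⋉ Y) π₁∘φ-natural (Slice⇒.△ (Fr.F₁ f))
      where
        π₁∘φ-natural : (P.π₁ Y ∘ φ.η Y) ∘ ⋉U.F₁ f ≈ f ∘ (P.π₁ X ∘ φ.η X)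
        π₁∘φ-natural = Eq.trans (pullʳ (φ.commute f)) (Eq.trans (pullˡ (P.project₁ Y)) assoc)

    Wk≡Fr : FunctorEq (Wk C U products⋉) (Fr M)
    Wk≡Fr = record { eq₀ = λ X → refl ; eq₁ = ×U₁≈⋉U₁ }

    ×U≡⋉U : FunctorEq (×U C U products⋉) (Multiplier.⋉U M)
    ×U≡⋉U = record { eq₀ = λ X → refl ; eq₁ = ×U₁≈⋉U₁ }

mainTheorem4 : ∀ {o ℓ e o′ ℓ′ e′ : Level} →
  -- (1) cancellative + affine + quantifiable ⇒ the counit ∃_U Fr_U → Id is a natural iso
  ( (W : Category o ℓ e) (V : Category o′ ℓ′ e′) (T : Terminal W) (U : Category.Obj V)
    (M : Multiplier W V T U) →
    Faithful (Fr M) → Full (Fr M) →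
    (∃U : Functor (Slice V U) W) (adj : ∃U ⊣ Fr M) →
    ∀ X → IsIso W (NatTrans.η (_⊣_.counit adj) X) )
  ×
  -- (2) semicartesian
  ( (C : Category o ℓ e) (T : Terminal C) (U : Category.Obj C) (M : Multiplier C C T U) →
    Semicartesian M →
      ( (∃U : Functor (Slice C U) C) → ∃U ⊣ Fr M → NatTrans (Dom C U) ∃U )
    × ( (P : ProductsWith C U) → NatTrans (Fr M) (Wk C U P) )
    × NatTrans (Dom C U ∘F Fr M) Idᶠ )
  ×
  -- (3) 3/4-cartesian
  ( (C : Category o ℓ e) (T : Terminal C) (U : Category.Obj C) (M : Multiplier C C T U) →
    (TQ : ThreeQuarterCartesian M) →
    NatTrans (SliceΣ (δU M TQ) ∘F Fr M) (Fr (double M)) )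
  ×
  -- (4) cartesian
  ( (C : Category o ℓ e) (T : Terminal C) (U : Category.Obj C) (M : Multiplier C C T U) →
    (Cart : Cartesian M) →
      ( (∃U : Functor (Slice C U) C) → ∃U ⊣ Fr M → NaturalIso ∃U (Dom C U) )
    × NaturalIso (Fr M) (Wk C U (Cartesian.products Cart))
    × ( (∃U : Functor (Slice C U) C) → ∃U ⊣ Fr M →
        NaturalIso (∃U ∘F Fr M) (Dom C U ∘F Wk C U (Cartesian.products Cart)) )
    × FunctorEq (Dom C U ∘F Wk C U (Cartesian.products Cart)) (×U C U (Cartesian.products Cart))
    × NaturalIso (×U C U (Cartesian.products Cart)) (Multiplier.⋉U M)
    -- equalities for a suitable choice: ∃_U := Dom_U, and Wk_U from products chosen on W ⋉ U
    × (Dom C U ⊣ Fr M)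
    × Σ (ProductsWith C U) (λ P →
          FunctorEq (Wk C U P) (Fr M) × FunctorEq (×U C U P) (Multiplier.⋉U M)) )
mainTheorem4 =
    (λ W V T U M faithful full ∃U adj → Adjunction.counit-isIso adj faithful full)
  , (λ C T U M sc → Dom⇒∃ M sc , Fr⇒Wk M sc , Dom∘Fr⇒Id M sc)
  , (λ C T U M tq → Σδ∘Fr⇒Fr² M tq)
  , (λ C T U M cart →
        ∃≅Dom M cart
      , Fr≅Wk M cart
      , ∃∘Fr≅Dom∘Wk M cart
      , Dom∘Wk≡×U (Cartesian.products cart)
      , NaturalIso-sym (Cartesian.φ cart)
      , Dom⊣Fr M cart
      , products⋉ M cart
      , Wk≡Fr M cart
      , ×U≡⋉U M cart)
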